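{- (a) Every graph $G$ with $\tau_4(G) \ge 1$ satisfies $e(G) \ge 2\tau_4(G) + 3$. (b) Consequently, for every $t \ge 1$, every graph $H \in \mathcal H_t$ (with $r=4$) has exactly $2t+3$ edges and $\tau_4(H) = t$, so the members of $\mathcal H_t$ are edge-minimal among graphs $G$ with $\tau_4(G) = t$.
   Context: $K_4$-bootstrap percolation: starting from a graph $G$ on vertex set $V$, set $G_0 := G$ and $G_{t+1} := G_t \cup \{e \in \binom{V}{2} : e \text{ is the only edge missing from } G_t \text{ in some copy of } K_4\}$; the saturation time is $\tau_4(G) := \min\{t \ge 0 : G_t = \bigcup_{s} G_s\}$, and $e(G)$ is the number of edges of $G$. The family $\mathcal H_t$ (for $r=4$): the body $H_0$ is a triangle $K_3$ on $V_0$; $\mathcal H_1 = \{K_4 - e\}$, i.e. $H_1$ is $H_0$ plus a vertex $v_1$ adjacent to exactly $2$ vertices of $V_0$, and $v_0$ is a vertex of $V_0$ adjacent to $v_1$. For $t \ge 2$, $H_t \in \mathcal H_t$ has vertex set $V_t = V_{t-1} \cup \{v_t\}$ and satisfies: (i) $H_t[V_{t-1}] \in \mathcal H_{t-1}$ (with distinguished vertices $v_1,\dots,v_{t-1}$); (ii) $v_{t-1} \in N(v_t)$; (iii) $|N(v_t)| = 2$; (iv) $N(v_t) \setminus \{v_{t-1}\} \not\subseteq N(v_{t-1})$. -}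

module Defs where

open import Data.Nat using (ℕ; zero; suc; _+_; _*_; _<_; _≤_)
open import Data.Fin using (Fin; toℕ; fromℕ; inject₁) renaming (zero to fz; suc to fs)
open import Data.Bool using (Bool; true; false; if_then_else_; _∧_)
open import Data.List using (List; map; allFin)
open import Data.Nat.ListAction using (sum)
open import Data.Product using (Σ; _×_; _,_; ∃)
open import Data.Empty using (⊥)
open import Data.Sum using (_⊎_)
open import Relation.Nullary using (¬_)
open import Relation.Nullary.Decidable using (⌊_⌋)
open import Relation.Binary.PropositionalEquality using (_≡_; _≢_)
import Data.Nat as ℕ

record Graph (n : ℕ) : Set where
  field
    adj    : Fin n → Fin n → Bool
    sym    : ∀ u v → adj u v ≡ adj v u
    irrefl : ∀ u → adj u u ≡ false
open Graph public

-- Edge relation of G_t in K4-bootstrap percolation.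
CompletesK4 : {n : ℕ} → (Fin n → Fin n → Set) → Fin n → Fin n → Set
CompletesK4 {n} R u v =
  Σ (Fin n) λ w → Σ (Fin n) λ x →
    (u ≢ v) × (u ≢ w) × (u ≢ x) × (v ≢ w) × (v ≢ x) × (w ≢ x) ×
    R u w × R u x × R v w × R v x × R w x

Step : {n : ℕ} → Graph n → ℕ → Fin n → Fin n → Set
Step G zero    u v = adj G u v ≡ true
Step G (suc t) u v = Step G t u v ⊎ CompletesK4 (Step G t) u v

IsFinal : {n : ℕ} → Graph n → ℕ → Set
IsFinal G t = ∀ s u v → Step G s u v → Step G t u v

SatTime : {n : ℕ} → Graph n → ℕ → Set
SatTime G t = IsFinal G t × (∀ t' → t' < t → ¬ IsFinal G t')

edgeCount : {n : ℕ} → Graph n → ℕ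
edgeCount {n} G =
  sum (map (λ u → sum (map (λ v →
    if ⌊ toℕ u ℕ.<? toℕ v ⌋ ∧ adj G u v then 1 else 0) (allFin n))) (allFin n))

degree : {n : ℕ} → Graph n → Fin n → ℕ
degree {n} G u = sum (map (λ v → if adj G u v then 1 else 0) (allFin n))

restrict : {n : ℕ} → Graph (suc n) → Graph n
restrict G = record
  { adj = λ u v → adj G (inject₁ u) (inject₁ v)
  ; sym = λ u v → sym G (inject₁ u) (inject₁ v)
  ; irrefl = λ u → irrefl G (inject₁ u) }

-- The family H_t (r = 4), with vertices labelled: V_0 = {0,1,2}, v_i = i + 2.
-- So H_t lives on Fin (3 + t), v_t is the last vertex fromℕ (2 + t), and
-- H_t[V_{t-1}] is the restriction to the first 2 + t vertices.
IsH : (t : ℕ) → Graph (3 + t) → Set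
IsH zero H =
  (adj H fz (fs fz) ≡ true) × (adj H fz (fs (fs fz)) ≡ true) × (adj H (fs fz) (fs (fs fz)) ≡ true)
IsH (suc zero) H =
  IsH zero (restrict H) × (degree H (fromℕ 3) ≡ 2)
IsH (suc (suc t)) H =
  IsH (suc t) (restrict H) ×
  (adj H vt vt₋₁ ≡ true) ×
  (degree H vt ≡ 2) ×
  (Σ (Fin (5 + t)) λ w →
     (adj H vt w ≡ true) × (w ≢ vt₋₁) × (adj H vt₋₁ w ≡ false))
  where
    vt : Fin (5 + t)
    vt = fromℕ (4 + t)
    vt₋₁ : Fin (5 + t)
    vt₋₁ = inject₁ (fromℕ (3 + t))

-- Call a vertex set X a cluster if it is a clique of G_{|X|-3}, and give it weight 2|X| - 3.
-- The edges of G are clusters of total weight e(G). Two clusters sharing two vertices, or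
-- three clusters pairwise sharing the vertices of a triangle, merge into one cluster of no
-- larger weight. Once no merge applies, every edge of every G_s lies inside a cluster, since
-- a K4 completed across clusters would allow a merge. Hence G saturates by time
-- max (|X| - 3), and 2|X| - 3 ≤ e(G) gives e(G) ≥ 2τ₄(G) + 3.
-- In H ∈ 𝓗_t the new vertex v_t is joined to v_{t-1} and to a non-neighbour w of v_{t-1}.
-- It gains no edge before v_{t-1}w appears at time t - 1, so H saturates exactly at time t,
-- and each added vertex brings two edges.
module Submission where

open import Defs renaming (sym to adj-sym)

open import Data.Bool using (Bool; true; false; if_then_else_; _∧_)
open import Data.Bool.Properties using (∧-conicalʳ)
open import Data.Empty using (⊥; ⊥-elim)
open import Data.Fin using (Fin; zero; suc; toℕ; fromℕ; inject₁; _↑ˡ_; _↑ʳ_; combine; remQuot)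
open import Data.Fin.Properties
  using (suc-injective; any?; toℕ-injective; remQuot-combine; inject₁-injective; fromℕ≢inject₁;
         toℕ-inject₁; toℕ-fromℕ; toℕ<n; ≤fromℕ)
  renaming (_≟_ to _≟ᶠ_)
open import Data.Fin.Relation.Unary.Top using (view; ‵fromℕ; ‵inject₁)
open import Data.Fin.Subset
  using (Subset; inside; outside; _∈_; _∉_; _⊆_; _∪_; _∩_; ⁅_⁆; Nonempty; ∣_∣)
  renaming (⊥ to ∅)
open import Data.Fin.Subset.Properties
open import Data.List using (map; allFin; tabulate)
open import Data.Nat
  using (ℕ; zero; suc; _+_; _*_; _∸_; _⊔_; _<?_; _≤?_; _≤_; _<_; z≤n; s≤s; s≤s⁻¹; z<s; _≤′_; ≤′-refl; ≤′-step)
open import Data.Nat.Induction using (<-wellFounded)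
import Data.Nat.ListAction as List
open import Data.Nat.Properties hiding (suc-injective; _≟_)
open import Data.Nat.Tactic.RingSolver using (solve-∀)
open import Data.Product using (_×_; _,_; ∃; ∃₂; proj₁; proj₂; uncurry)
open import Data.Sum using (_⊎_; inj₁; inj₂)
import Data.Sum as Sum
open import Data.Vec using (_∷_; []; here; there)
import Data.Vec as Vec
open import Data.Vec.Properties using (lookup⇒[]=; []=⇒lookup; lookup∘tabulate)
open import Data.Vec.Functional using (Vector; updateAt)
open import Data.Vec.Functional.Properties using (updateAt-updates; updateAt-minimal)
open import Function using (_∘_; const)
open import Induction.WellFounded using (Acc; acc)
open import Relation.Binary.Definitions using (tri<; tri≈; tri>)
open import Relation.Binary.PropositionalEquality
open import Relation.Nullary using (¬_; Dec; yes; no; ¬?; _×-dec_)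
open import Relation.Nullary.Decidable using (map′; ⌊_⌋)
open import Relation.Nullary.Negation using (contradiction)

open import Algebra.Properties.CommutativeMonoid.Sum +-0-commutativeMonoid
  using (sum; sum-remove; sum-cong-≗; sum-init-last; ∑-distrib-+; sum-replicate-zero)

private
  variable
    n : ℕ

sum-map-allFin : ∀ (f : Fin n → ℕ) → List.sum (map f (allFin n)) ≡ sum f
sum-map-allFin f = go f (λ i → i)
  where
  go : ∀ {n} {A : Set} (f : A → ℕ) (g : Fin n → A) → List.sum (map f (tabulate g)) ≡ sum (f ∘ g)
  go {zero} f g = refl
  go {suc n} f g = cong (f (g zero) +_) (go f (g ∘ suc))

sum-mono : ∀ {n} {f g : Vector ℕ n} → (∀ i → f i ≤ g i) → sum f ≤ sum g
sum-mono {zero} f≤g = z≤n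
sum-mono {suc n} f≤g = +-mono-≤ (f≤g zero) (sum-mono (f≤g ∘ suc))

≤-sum : ∀ {n} (f : Vector ℕ n) i → f i ≤ sum f
≤-sum {suc n} f i = ≤-trans (m≤m+n (f i) _) (≤-reflexive (sym (sum-remove {i = i} f)))

sum-updateAt : ∀ {n} {A : Set} (w : A → ℕ) (F : Vector A n) i h →
               sum (w ∘ updateAt F i h) + w (F i) ≡ sum (w ∘ F) + w (h (F i))
sum-updateAt {suc n} w F zero h =
  trans (+-assoc (w (h (F zero))) _ _)
        (trans (+-comm (w (h (F zero))) _) (cong (_+ w (h (F zero))) (+-comm _ (w (F zero)))))
sum-updateAt {suc n} w F (suc i) h =
  trans (+-assoc (w (F zero)) _ _)
        (trans (cong (w (F zero) +_) (sum-updateAt w (F ∘ suc) i h)) (sym (+-assoc (w (F zero)) _ _)))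

sum-↑ : ∀ m {n} (f : Vector ℕ (m + n)) → sum f ≡ sum (f ∘ (_↑ˡ n)) + sum (f ∘ (m ↑ʳ_))
sum-↑ zero f = refl
sum-↑ (suc m) f = trans (cong (f zero +_) (sum-↑ m (f ∘ suc))) (sym (+-assoc (f zero) _ _))

sum-combine : ∀ m n (f : Vector ℕ (m * n)) → sum f ≡ sum (λ i → sum (λ j → f (combine {m} {n} i j)))
sum-combine zero n f = refl
sum-combine (suc m) n f = trans (sum-↑ n f) (cong (sum (f ∘ (_↑ˡ m * n)) +_) (sum-combine m n (f ∘ (n ↑ʳ_))))

∣p∪q∣+∣p∩q∣≡∣p∣+∣q∣ : ∀ (p q : Subset n) → ∣ p ∪ q ∣ + ∣ p ∩ q ∣ ≡ ∣ p ∣ + ∣ q ∣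
∣p∪q∣+∣p∩q∣≡∣p∣+∣q∣ [] [] = refl
∣p∪q∣+∣p∩q∣≡∣p∣+∣q∣ (outside ∷ p) (outside ∷ q) = ∣p∪q∣+∣p∩q∣≡∣p∣+∣q∣ p q
∣p∪q∣+∣p∩q∣≡∣p∣+∣q∣ (inside ∷ p) (outside ∷ q) = cong suc (∣p∪q∣+∣p∩q∣≡∣p∣+∣q∣ p q)
∣p∪q∣+∣p∩q∣≡∣p∣+∣q∣ (outside ∷ p) (inside ∷ q) =
  trans (cong suc (∣p∪q∣+∣p∩q∣≡∣p∣+∣q∣ p q)) (sym (+-suc ∣ p ∣ ∣ q ∣))
∣p∪q∣+∣p∩q∣≡∣p∣+∣q∣ (inside ∷ p) (inside ∷ q) =
  trans (cong suc (+-suc ∣ p ∪ q ∣ _)) (cong suc (trans (cong suc (∣p∪q∣+∣p∩q∣≡∣p∣+∣q∣ p q)) (sym (+-suc ∣ p ∣ ∣ q ∣))))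

∣p∪q∣≤∣p∣+∣q∣ : ∀ (p q : Subset n) → ∣ p ∪ q ∣ ≤ ∣ p ∣ + ∣ q ∣
∣p∪q∣≤∣p∣+∣q∣ p q = ≤-trans (m≤m+n _ _) (≤-reflexive (∣p∪q∣+∣p∩q∣≡∣p∣+∣q∣ p q))

x∈p⇒1≤∣p∣ : ∀ {p : Subset n} {x} → x ∈ p → 1 ≤ ∣ p ∣
x∈p⇒1≤∣p∣ x∈p = ≤-trans (s≤s z≤n) (x∈p⇒∣p-x∣<∣p∣ x∈p)

distinct⇒2≤∣p∣ : ∀ {p : Subset n} {x y} → x ≢ y → x ∈ p → y ∈ p → 2 ≤ ∣ p ∣
distinct⇒2≤∣p∣ x≢y x∈p y∈p =
  ≤-trans (s≤s (x∈p⇒1≤∣p∣ (x∈p∧x≢y⇒x∈p-y y∈p (x≢y ∘ sym)))) (x∈p⇒∣p-x∣<∣p∣ x∈p)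

distinct⇒3≤∣p∣ : ∀ {p : Subset n} {x y z} → x ≢ y → x ≢ z → y ≢ z → x ∈ p → y ∈ p → z ∈ p → 3 ≤ ∣ p ∣
distinct⇒3≤∣p∣ x≢y x≢z y≢z x∈p y∈p z∈p =
  ≤-trans (s≤s (distinct⇒2≤∣p∣ y≢z (x∈p∧x≢y⇒x∈p-y y∈p (x≢y ∘ sym)) (x∈p∧x≢y⇒x∈p-y z∈p (x≢z ∘ sym))))
          (x∈p⇒∣p-x∣<∣p∣ x∈p)

∣p∣≤2⇒pair : ∀ {p : Subset n} {x y} → x ≢ y → x ∈ p → y ∈ p → ∣ p ∣ ≤ 2 → ∀ {z} → z ∈ p → z ≡ x ⊎ z ≡ y
∣p∣≤2⇒pair {x = x} {y} x≢y x∈p y∈p ∣p∣≤2 {z} z∈p with z ≟ᶠ x | z ≟ᶠ y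
... | yes z≡x | _ = inj₁ z≡x
... | no _ | yes z≡y = inj₂ z≡y
... | no z≢x | no z≢y = contradiction (distinct⇒3≤∣p∣ x≢y (z≢x ∘ sym) (z≢y ∘ sym) x∈p y∈p z∈p) (<⇒≱ (s≤s ∣p∣≤2))

⊆∧∣∣≤⇒⊇ : ∀ {p q : Subset n} → p ⊆ q → ∣ q ∣ ≤ ∣ p ∣ → q ⊆ p
⊆∧∣∣≤⇒⊇ {p = p} p⊆q ∣q∣≤∣p∣ {x} x∈q with x ∈? p
... | yes x∈p = x∈p
... | no x∉p = contradiction (p⊂q⇒∣p∣<∣q∣ (p⊆q , x , x∈q , x∉p)) (≤⇒≯ ∣q∣≤∣p∣)

1≤∣p∣⇒nonempty : ∀ {p : Subset n} → 1 ≤ ∣ p ∣ → Nonempty p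
1≤∣p∣⇒nonempty {p = inside ∷ p} _ = zero , here
1≤∣p∣⇒nonempty {p = outside ∷ p} 1≤∣p∣ with 1≤∣p∣⇒nonempty 1≤∣p∣
... | x , x∈p = suc x , there x∈p

2≤∣p∣⇒distinct : ∀ {p : Subset n} → 2 ≤ ∣ p ∣ → ∃₂ λ x y → x ≢ y × x ∈ p × y ∈ p
2≤∣p∣⇒distinct {p = inside ∷ p} (s≤s 1≤∣p∣) with 1≤∣p∣⇒nonempty 1≤∣p∣
... | y , y∈p = zero , suc y , (λ ()) , here , there y∈p
2≤∣p∣⇒distinct {p = outside ∷ p} 2≤∣p∣ with 2≤∣p∣⇒distinct 2≤∣p∣
... | x , y , x≢y , x∈p , y∈p = suc x , suc y , x≢y ∘ suc-injective , there x∈p , there y∈p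

∣tabulate∣ : ∀ (f : Fin n → Bool) → ∣ Vec.tabulate f ∣ ≡ sum (λ i → if f i then 1 else 0)
∣tabulate∣ {zero} f = refl
∣tabulate∣ {suc n} f with f zero
... | true = cong suc (∣tabulate∣ (f ∘ suc))
... | false = ∣tabulate∣ (f ∘ suc)

∪-least : ∀ {p q r : Subset n} → p ⊆ r → q ⊆ r → p ∪ q ⊆ r
∪-least {p = p} {q} p⊆r q⊆r x∈p∪q = Sum.[ p⊆r , q⊆r ] (x∈p∪q⁻ p q x∈p∪q)

∪-mono : ∀ {p p′ q q′ : Subset n} → p ⊆ p′ → q ⊆ q′ → p ∪ q ⊆ p′ ∪ q′
∪-mono {p′ = p′} {q′ = q′} p⊆p′ q⊆q′ = ∪-least (p⊆p∪q q′ ∘ p⊆p′) (q⊆p∪q p′ q′ ∘ q⊆q′)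

∪-rotate : ∀ (X Y Z : Subset n) → Y ∪ Z ∪ X ≡ X ∪ Y ∪ Z
∪-rotate X Y Z = sym (trans (∪-comm X (Y ∪ Z)) (∪-assoc Y Z X))

SharePair : Subset n → Subset n → Set
SharePair X Y = ∃₂ λ x y → x ≢ y × x ∈ X ∩ Y × y ∈ X ∩ Y

SharePair-sym : ∀ {p q : Subset n} → SharePair p q → SharePair q p
SharePair-sym {p = p} {q} (x , y , x≢y , x∈p∩q , y∈p∩q) =
  x , y , x≢y , subst (x ∈_) (∩-comm p q) x∈p∩q , subst (y ∈_) (∩-comm p q) y∈p∩q

∣p∪q∣+2≤∣p∣+∣q∣ : ∀ {p q : Subset n} → SharePair p q → ∣ p ∪ q ∣ + 2 ≤ ∣ p ∣ + ∣ q ∣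
∣p∪q∣+2≤∣p∣+∣q∣ {p = p} {q} (x , y , x≢y , x∈p∩q , y∈p∩q) =
  ≤-trans (+-monoʳ-≤ ∣ p ∪ q ∣ (distinct⇒2≤∣p∣ x≢y x∈p∩q y∈p∩q)) (≤-reflexive (∣p∪q∣+∣p∩q∣≡∣p∣+∣q∣ p q))

∣p∣+2≤∣p∪q∣ : ∀ {p q : Subset n} → ¬ SharePair p q → 3 ≤ ∣ q ∣ → ∣ p ∣ + 2 ≤ ∣ p ∪ q ∣
∣p∣+2≤∣p∪q∣ {p = p} {q} ¬pq 3≤∣q∣ = +-cancelʳ-≤ 1 _ _ (begin
  ∣ p ∣ + 2 + 1         ≡⟨ +-assoc ∣ p ∣ 2 1 ⟩
  ∣ p ∣ + 3             ≤⟨ +-monoʳ-≤ ∣ p ∣ 3≤∣q∣ ⟩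
  ∣ p ∣ + ∣ q ∣         ≡⟨ sym (∣p∪q∣+∣p∩q∣≡∣p∣+∣q∣ p q) ⟩
  ∣ p ∪ q ∣ + ∣ p ∩ q ∣ ≤⟨ +-monoʳ-≤ ∣ p ∪ q ∣ ∣p∩q∣≤1 ⟩
  ∣ p ∪ q ∣ + 1         ∎)
  where
  open ≤-Reasoning
  ∣p∩q∣≤1 : ∣ p ∩ q ∣ ≤ 1
  ∣p∩q∣≤1 = s≤s⁻¹ (≰⇒> (¬pq ∘ 2≤∣p∣⇒distinct))

record Triangle (X Y Z : Subset n) : Set where
  constructor triangle
  field
    {p q r} : Fin n
    p≢q : p ≢ q
    q≢r : q ≢ r
    r≢p : r ≢ p
    p∈Z : p ∈ Z
    p∈X : p ∈ X
    q∈X : q ∈ X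
    q∈Y : q ∈ Y
    r∈Y : r ∈ Y
    r∈Z : r ∈ Z

rotate : ∀ {X Y Z : Subset n} → Triangle X Y Z → Triangle Y Z X
rotate (triangle p≢q q≢r r≢p p∈Z p∈X q∈X q∈Y r∈Y r∈Z) = triangle q≢r r≢p p≢q q∈X q∈Y r∈Y r∈Z p∈Z p∈X

NoSharedPairs : Subset n → Subset n → Subset n → Set
NoSharedPairs X Y Z = ¬ SharePair X Y × ¬ SharePair Y Z × ¬ SharePair Z X

rotate-NoSharedPairs : ∀ {X Y Z : Subset n} → NoSharedPairs X Y Z → NoSharedPairs Y Z X
rotate-NoSharedPairs (¬XY , ¬YZ , ¬ZX) = ¬YZ , ¬ZX , ¬XY

sharePair? : ∀ (X Y : Subset n) → Dec (SharePair X Y)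
sharePair? X Y = any? λ x → any? λ y → ¬? (x ≟ᶠ y) ×-dec x ∈? X ∩ Y ×-dec y ∈? X ∩ Y

triangle? : ∀ (X Y Z : Subset n) → Dec (Triangle X Y Z)
triangle? X Y Z = map′ toTriangle fromTriangle
  (any? λ p → any? λ q → any? λ r →
    ¬? (p ≟ᶠ q) ×-dec ¬? (q ≟ᶠ r) ×-dec ¬? (r ≟ᶠ p) ×-dec
    p ∈? Z ×-dec p ∈? X ×-dec q ∈? X ×-dec q ∈? Y ×-dec r ∈? Y ×-dec r ∈? Z)
  where
  Witness : Set
  Witness = ∃ λ p → ∃ λ q → ∃ λ r →
    p ≢ q × q ≢ r × r ≢ p × p ∈ Z × p ∈ X × q ∈ X × q ∈ Y × r ∈ Y × r ∈ Z
  toTriangle : Witness → Triangle X Y Z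
  toTriangle (_ , _ , _ , p≢q , q≢r , r≢p , p∈Z , p∈X , q∈X , q∈Y , r∈Y , r∈Z) =
    triangle p≢q q≢r r≢p p∈Z p∈X q∈X q∈Y r∈Y r∈Z
  fromTriangle : Triangle X Y Z → Witness
  fromTriangle (triangle p≢q q≢r r≢p p∈Z p∈X q∈X q∈Y r∈Y r∈Z) =
    _ , _ , _ , p≢q , q≢r , r≢p , p∈Z , p∈X , q∈X , q∈Y , r∈Y , r∈Z

∣p∪q∪r∣+3≤∣p∣+∣q∣+∣r∣ : ∀ {X Y Z : Subset n} → Triangle X Y Z → ∣ X ∪ Y ∪ Z ∣ + 3 ≤ ∣ X ∣ + (∣ Y ∣ + ∣ Z ∣)
∣p∪q∪r∣+3≤∣p∣+∣q∣+∣r∣ {X = X} {Y} {Z} (triangle p≢q q≢r r≢p p∈Z p∈X q∈X q∈Y r∈Y r∈Z) = begin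
  ∣ U ∣ + 3                                   ≤⟨ +-monoʳ-≤ ∣ U ∣ (+-mono-≤ 2≤∣X∩[Y∪Z]∣ 1≤∣Y∩Z∣) ⟩
  ∣ U ∣ + (∣ X ∩ (Y ∪ Z) ∣ + ∣ Y ∩ Z ∣)       ≡⟨ sym (+-assoc ∣ U ∣ _ _) ⟩
  ∣ U ∣ + ∣ X ∩ (Y ∪ Z) ∣ + ∣ Y ∩ Z ∣         ≡⟨ cong (_+ ∣ Y ∩ Z ∣) (∣p∪q∣+∣p∩q∣≡∣p∣+∣q∣ X (Y ∪ Z)) ⟩
  ∣ X ∣ + ∣ Y ∪ Z ∣ + ∣ Y ∩ Z ∣               ≡⟨ +-assoc ∣ X ∣ _ _ ⟩
  ∣ X ∣ + (∣ Y ∪ Z ∣ + ∣ Y ∩ Z ∣)             ≡⟨ cong (∣ X ∣ +_) (∣p∪q∣+∣p∩q∣≡∣p∣+∣q∣ Y Z) ⟩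
  ∣ X ∣ + (∣ Y ∣ + ∣ Z ∣)                     ∎
  where
  open ≤-Reasoning
  U : Subset _
  U = X ∪ Y ∪ Z
  2≤∣X∩[Y∪Z]∣ : 2 ≤ ∣ X ∩ (Y ∪ Z) ∣
  2≤∣X∩[Y∪Z]∣ = distinct⇒2≤∣p∣ p≢q (x∈p∩q⁺ (p∈X , q⊆p∪q Y Z p∈Z)) (x∈p∩q⁺ (q∈X , p⊆p∪q Z q∈Y))
  1≤∣Y∩Z∣ : 1 ≤ ∣ Y ∩ Z ∣
  1≤∣Y∩Z∣ = x∈p⇒1≤∣p∣ (x∈p∩q⁺ (r∈Y , r∈Z))

∸3-mono-< : ∀ {x y u} → u + 2 ≤ x + y → x < u → y < u → x ∸ 3 < u ∸ 3
∸3-mono-< {x} {y} {u} u+2≤x+y x<u y<u = ∸-monoˡ-< x<u 3≤x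
  where
  3≤x : 3 ≤ x
  3≤x = +-cancelˡ-≤ u 3 x (begin
    u + 3       ≡⟨ +-suc u 2 ⟩
    suc (u + 2) ≤⟨ s≤s u+2≤x+y ⟩
    suc (x + y) ≡⟨ sym (+-suc x y) ⟩
    x + suc y   ≤⟨ +-monoʳ-≤ x y<u ⟩
    x + u       ≡⟨ +-comm x u ⟩
    u + x       ∎)
    where open ≤-Reasoning

∸3-+2 : ∀ {w u} → 5 ≤ u → (3 ≤ w → w + 2 ≤ u) → 2 + (w ∸ 3) ≤ u ∸ 3
∸3-+2 {w} {u} 5≤u big⇒w+2≤u with 3 ≤? w
... | no w<3 = subst (λ t → 2 + t ≤ u ∸ 3) (sym (m≤n⇒m∸n≡0 (≤-trans (s≤s⁻¹ (≰⇒> w<3)) (n≤1+n 2)))) (∸-monoˡ-≤ 3 5≤u)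
... | yes 3≤w = begin
  2 + (w ∸ 3) ≡⟨ sym (+-∸-assoc 2 3≤w) ⟩
  2 + w ∸ 3   ≤⟨ ∸-monoˡ-≤ 3 (≤-trans (≤-reflexive (+-comm 2 w)) (big⇒w+2≤u 3≤w)) ⟩
  u ∸ 3       ∎
  where open ≤-Reasoning

∸3-≤ : ∀ {a b} → a + 3 ≤ b + 6 → a ∸ 3 ≤ b
∸3-≤ {a} {b} a+3≤b+6 = m≤n+o⇒m∸n≤o a 3 (+-cancelʳ-≤ 3 a (3 + b) (≤-trans a+3≤b+6 (≤-reflexive b+6≡3+b+3)))
  where
  b+6≡3+b+3 : b + 6 ≡ 3 + b + 3
  b+6≡3+b+3 = trans (sym (+-assoc b 3 3)) (+-comm (b + 3) 3)

+≡+⇒≤ : ∀ {a b c d} → a + b ≡ c + d → d ≤ b → a ≤ c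
+≡+⇒≤ {a} {b} {c} {d} eq d≤b = +-cancelʳ-≤ b a c (≤-trans (≤-reflexive eq) (+-monoʳ-≤ c d≤b))

+≡+⇒< : ∀ {a b c d} → a + b ≡ c + d → d < b → a < c
+≡+⇒< {a} {b} {c} {d} eq d<b =
  +-cancelʳ-< b a c (≤-trans (s≤s (≤-reflexive eq)) (≤-trans (≤-reflexive (sym (+-suc c d))) (+-monoʳ-≤ c d<b)))

weight≤⇒time≤ : ∀ {x t} → 2 * x ∸ 3 ≤ 2 * t + 2 → x ∸ 3 ≤ t ∸ 1
weight≤⇒time≤ {x} {t} weight≤ = begin
  x ∸ 3       ≤⟨ ∸-monoˡ-≤ 3 (s≤s⁻¹ (subst (x <_) (+-suc t 2) x<t+3)) ⟩
  t + 2 ∸ 3   ≡⟨ sym (∸-+-assoc (t + 2) 2 1) ⟩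
  t + 2 ∸ 2 ∸ 1 ≡⟨ cong (_∸ 1) (m+n∸n≡m t 2) ⟩
  t ∸ 1       ∎
  where
  open ≤-Reasoning
  x<t+3 : x < t + 3
  x<t+3 = *-cancelˡ-< 2 x (t + 3) (begin-strict
    2 * x                 ≤⟨ m≤n+m∸n (2 * x) 3 ⟩
    3 + (2 * x ∸ 3)       ≤⟨ +-monoʳ-≤ 3 weight≤ ⟩
    3 + (2 * t + 2)       <⟨ n<1+n _ ⟩
    4 + (2 * t + 2)       ≡⟨ 4+[2t+2]≡2[t+3] t ⟩
    2 * (t + 3)           ∎)
    where
    4+[2t+2]≡2[t+3] : ∀ t → 4 + (2 * t + 2) ≡ 2 * (t + 3)
    4+[2t+2]≡2[t+3] = solve-∀

-- Cliques of the bootstrap process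

module _ (G : Graph n) where

  neighbours : Fin n → Subset n
  neighbours v = Vec.tabulate (adj G v)

  ∈-neighbours⁺ : ∀ {v w} → adj G v w ≡ true → w ∈ neighbours v
  ∈-neighbours⁺ {v} {w} vw = lookup⇒[]= w _ (trans (lookup∘tabulate (adj G v) w) vw)

  ∈-neighbours⁻ : ∀ {v w} → w ∈ neighbours v → adj G v w ≡ true
  ∈-neighbours⁻ {v} {w} w∈N = trans (sym (lookup∘tabulate (adj G v) w)) ([]=⇒lookup w∈N)

  degree≡∣neighbours∣ : ∀ v → degree G v ≡ ∣ neighbours v ∣
  degree≡∣neighbours∣ v = trans (sum-map-allFin (λ w → if adj G v w then 1 else 0)) (sym (∣tabulate∣ (adj G v)))

  Step-irrefl : ∀ s {a b} → Step G s a b → a ≢ b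
  Step-irrefl zero ab refl = contradiction (trans (sym ab) (irrefl G _)) (λ ())
  Step-irrefl (suc s) (inj₁ ab) = Step-irrefl s ab
  Step-irrefl (suc s) (inj₂ (_ , _ , a≢b , _)) = a≢b

  Step-sym : ∀ s {a b} → Step G s a b → Step G s b a
  Step-sym zero ab = trans (adj-sym G _ _) ab
  Step-sym (suc s) (inj₁ ab) = inj₁ (Step-sym s ab)
  Step-sym (suc s) (inj₂ (w , x , a≢b , a≢w , a≢x , b≢w , b≢x , w≢x , aw , ax , bw , bx , wx)) =
    inj₂ (w , x , a≢b ∘ sym , b≢w , b≢x , a≢w , a≢x , w≢x , bw , bx , aw , ax , wx)

  Step-mono : ∀ {s s′ a b} → s ≤ s′ → Step G s a b → Step G s′ a b
  Step-mono s≤s′ = go (≤⇒≤′ s≤s′)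
    where
    go : ∀ {s s′ a b} → s ≤′ s′ → Step G s a b → Step G s′ a b
    go ≤′-refl ab = ab
    go (≤′-step s≤s′) ab = inj₁ (go s≤s′ ab)

  IsClique : ℕ → Subset n → Set
  IsClique s X = ∀ {a b} → a ∈ X → b ∈ X → a ≢ b → Step G s a b

  clique-mono : ∀ {s s′ X} → s ≤ s′ → IsClique s X → IsClique s′ X
  clique-mono s≤s′ cX a∈X b∈X a≢b = Step-mono s≤s′ (cX a∈X b∈X a≢b)

  clique-⊆ : ∀ {s X Y} → Y ⊆ X → IsClique s X → IsClique s Y
  clique-⊆ Y⊆X cX a∈Y b∈Y = cX (Y⊆X a∈Y) (Y⊆X b∈Y)

  ∅-clique : ∀ {s} → IsClique s ∅
  ∅-clique a∈∅ = contradiction a∈∅ ∉⊥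

  pair-clique : ∀ {s x y} → Step G s x y → IsClique s (⁅ x ⁆ ∪ ⁅ y ⁆)
  pair-clique {s} {x} {y} xy a∈ b∈ a≢b with x∈p∪q⁻ ⁅ x ⁆ ⁅ y ⁆ a∈ | x∈p∪q⁻ ⁅ x ⁆ ⁅ y ⁆ b∈
  ... | inj₁ a∈x | inj₁ b∈x = contradiction (trans (x∈⁅y⁆⇒x≡y x a∈x) (sym (x∈⁅y⁆⇒x≡y x b∈x))) a≢b
  ... | inj₂ a∈y | inj₂ b∈y = contradiction (trans (x∈⁅y⁆⇒x≡y y a∈y) (sym (x∈⁅y⁆⇒x≡y y b∈y))) a≢b
  ... | inj₁ a∈x | inj₂ b∈y rewrite x∈⁅y⁆⇒x≡y x a∈x | x∈⁅y⁆⇒x≡y y b∈y = xy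
  ... | inj₂ a∈y | inj₁ b∈x rewrite x∈⁅y⁆⇒x≡y y a∈y | x∈⁅y⁆⇒x≡y x b∈x = Step-sym s xy

  -- If neither endpoint lies in both cliques, a b x y spans a K4 minus ab.
  ∪-clique-across : ∀ {s X Y} → SharePair X Y → IsClique s X → IsClique s Y →
                    ∀ {a b} → a ∈ X → b ∈ Y → a ≢ b → Step G (suc s) a b
  ∪-clique-across {X = X} {Y} (x , y , x≢y , x∈X∩Y , y∈X∩Y) cX cY {a} {b} a∈X b∈Y a≢b
    with a ∈? Y | b ∈? X
  ... | yes a∈Y | _ = inj₁ (cY a∈Y b∈Y a≢b)
  ... | no _ | yes b∈X = inj₁ (cX a∈X b∈X a≢b)
  ... | no a∉Y | no b∉X =
    inj₂ (x , y , a≢b , ∉Y x∈Y , ∉Y y∈Y , ∉X x∈X , ∉X y∈X , x≢y ,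
          cX a∈X x∈X (∉Y x∈Y) , cX a∈X y∈X (∉Y y∈Y) , cY b∈Y x∈Y (∉X x∈X) , cY b∈Y y∈Y (∉X y∈X) , cX x∈X y∈X x≢y)
    where
    x∈X : x ∈ X
    x∈X = proj₁ (x∈p∩q⁻ X Y x∈X∩Y)
    x∈Y : x ∈ Y
    x∈Y = proj₂ (x∈p∩q⁻ X Y x∈X∩Y)
    y∈X : y ∈ X
    y∈X = proj₁ (x∈p∩q⁻ X Y y∈X∩Y)
    y∈Y : y ∈ Y
    y∈Y = proj₂ (x∈p∩q⁻ X Y y∈X∩Y)
    ∉Y : ∀ {z} → z ∈ Y → a ≢ z
    ∉Y z∈Y refl = a∉Y z∈Y
    ∉X : ∀ {z} → z ∈ X → b ≢ z
    ∉X z∈X refl = b∉X z∈X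

  ∪-clique : ∀ {s X Y} → SharePair X Y → IsClique s X → IsClique s Y → IsClique (suc s) (X ∪ Y)
  ∪-clique {s} {X} {Y} XY cX cY a∈U b∈U a≢b with x∈p∪q⁻ X Y a∈U | x∈p∪q⁻ X Y b∈U
  ... | inj₁ a∈X | inj₁ b∈X = inj₁ (cX a∈X b∈X a≢b)
  ... | inj₂ a∈Y | inj₂ b∈Y = inj₁ (cY a∈Y b∈Y a≢b)
  ... | inj₁ a∈X | inj₂ b∈Y = ∪-clique-across XY cX cY a∈X b∈Y a≢b
  ... | inj₂ a∈Y | inj₁ b∈X = Step-sym (suc s) (∪-clique-across XY cX cY b∈X a∈Y (a≢b ∘ sym))

  ∪₃-clique : ∀ {s X Y Z} → IsClique s (X ∪ Y) → IsClique s (Y ∪ Z) → IsClique s (Z ∪ X) →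
              IsClique s (X ∪ Y ∪ Z)
  ∪₃-clique {X = X} {Y} {Z} cXY cYZ cZX a∈U b∈U with ∈∪₃ a∈U | ∈∪₃ b∈U
    where
    ∈∪₃ : ∀ {c} → c ∈ X ∪ Y ∪ Z → c ∈ X ⊎ c ∈ Y ⊎ c ∈ Z
    ∈∪₃ c∈U = Sum.map₂ (x∈p∪q⁻ Y Z) (x∈p∪q⁻ X (Y ∪ Z) c∈U)
  ... | inj₁ a∈X        | inj₁ b∈X        = cXY (p⊆p∪q Y a∈X) (p⊆p∪q Y b∈X)
  ... | inj₁ a∈X        | inj₂ (inj₁ b∈Y) = cXY (p⊆p∪q Y a∈X) (q⊆p∪q X Y b∈Y)
  ... | inj₁ a∈X        | inj₂ (inj₂ b∈Z) = cZX (q⊆p∪q Z X a∈X) (p⊆p∪q X b∈Z)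
  ... | inj₂ (inj₁ a∈Y) | inj₁ b∈X        = cXY (q⊆p∪q X Y a∈Y) (p⊆p∪q Y b∈X)
  ... | inj₂ (inj₁ a∈Y) | inj₂ (inj₁ b∈Y) = cYZ (p⊆p∪q Z a∈Y) (p⊆p∪q Z b∈Y)
  ... | inj₂ (inj₁ a∈Y) | inj₂ (inj₂ b∈Z) = cYZ (p⊆p∪q Z a∈Y) (q⊆p∪q Y Z b∈Z)
  ... | inj₂ (inj₂ a∈Z) | inj₁ b∈X        = cZX (p⊆p∪q X a∈Z) (q⊆p∪q Z X b∈X)
  ... | inj₂ (inj₂ a∈Z) | inj₂ (inj₁ b∈Y) = cYZ (q⊆p∪q Y Z a∈Z) (p⊆p∪q Z b∈Y)
  ... | inj₂ (inj₂ a∈Z) | inj₂ (inj₂ b∈Z) = cYZ (q⊆p∪q Y Z a∈Z) (q⊆p∪q Y Z b∈Z)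

  Cluster : Subset n → Set
  Cluster X = IsClique (∣ X ∣ ∸ 3) X

  cluster-⊆ : ∀ {X Y} → Y ⊆ X → ∣ X ∣ ≤ ∣ Y ∣ → Cluster X → Cluster Y
  cluster-⊆ Y⊆X ∣X∣≤∣Y∣ cX = clique-mono (∸-monoˡ-≤ 3 ∣X∣≤∣Y∣) (clique-⊆ Y⊆X cX)

  -- Unless X ∪ Y equals X or Y, it is larger than both, which pays for the step of ∪-clique.
  ∪-cluster : ∀ {X Y} → SharePair X Y → Cluster X → Cluster Y → Cluster (X ∪ Y)
  ∪-cluster {X} {Y} XY cX cY with ∣ X ∣ <? ∣ X ∪ Y ∣ | ∣ Y ∣ <? ∣ X ∪ Y ∣
  ... | no X≮U | _ = cluster-⊆ (⊆∧∣∣≤⇒⊇ (p⊆p∪q Y) (≮⇒≥ X≮U)) (∣p∣≤∣p∪q∣ X Y) cX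
  ... | yes _ | no Y≮U = cluster-⊆ (⊆∧∣∣≤⇒⊇ (q⊆p∪q X Y) (≮⇒≥ Y≮U)) (∣q∣≤∣p∪q∣ X Y) cY
  ... | yes X<U | yes Y<U =
    clique-mono (⊔-lub (∸3-mono-< U+2≤ X<U Y<U) (∸3-mono-< (≤-trans U+2≤ (≤-reflexive (+-comm ∣ X ∣ ∣ Y ∣))) Y<U X<U))
      (∪-clique XY (clique-mono (m≤m⊔n _ _) cX) (clique-mono (m≤n⊔m _ _) cY))
    where
    U+2≤ : ∣ X ∪ Y ∣ + 2 ≤ ∣ X ∣ + ∣ Y ∣
    U+2≤ = ∣p∪q∣+2≤∣p∣+∣q∣ XY

  -- Δ = {p, q, r} is a clique by the latest time m of X, Y, Z. Gluing Δ to each cluster and then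
  -- the results pairwise gives U at time m + 2, early enough when two clusters have three or more
  -- vertices. Otherwise, up to rotation, U is Δ or X ∪ Δ, which is reached at time m + 1.
  module TriangleMerge {X Y Z} (sparse : NoSharedPairs X Y Z) (T : Triangle X Y Z)
                       (cX : Cluster X) (cY : Cluster Y) (cZ : Cluster Z) where
    open Triangle T

    U Δ : Subset n
    U = X ∪ Y ∪ Z
    Δ = ⁅ p ⁆ ∪ ⁅ q ⁆ ∪ ⁅ r ⁆

    p∈Δ : p ∈ Δ
    p∈Δ = p⊆p∪q _ (x∈⁅x⁆ p)
    q∈Δ : q ∈ Δ
    q∈Δ = q⊆p∪q ⁅ p ⁆ _ (p⊆p∪q ⁅ r ⁆ (x∈⁅x⁆ q))
    r∈Δ : r ∈ Δ
    r∈Δ = q⊆p∪q ⁅ p ⁆ _ (q⊆p∪q ⁅ q ⁆ ⁅ r ⁆ (x∈⁅x⁆ r))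

    tX tY tZ m : ℕ
    tX = ∣ X ∣ ∸ 3
    tY = ∣ Y ∣ ∸ 3
    tZ = ∣ Z ∣ ∸ 3
    m = tX ⊔ (tY ⊔ tZ)

    cX′ : IsClique m X
    cX′ = clique-mono (m≤m⊔n tX (tY ⊔ tZ)) cX
    cY′ : IsClique m Y
    cY′ = clique-mono (≤-trans (m≤m⊔n tY tZ) (m≤n⊔m tX (tY ⊔ tZ))) cY
    cZ′ : IsClique m Z
    cZ′ = clique-mono (≤-trans (m≤n⊔m tY tZ) (m≤n⊔m tX (tY ⊔ tZ))) cZ

    Δ-clique : IsClique m Δ
    Δ-clique = ∪₃-clique (pair-clique (cX′ p∈X q∈X p≢q)) (pair-clique (cY′ q∈Y r∈Y q≢r))
                         (pair-clique (cZ′ r∈Z p∈Z r≢p))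

    shared : ∀ {x y} {V W : Subset n} → x ≢ y → x ∈ V → y ∈ V → x ∈ W → y ∈ W → SharePair V W
    shared x≢y x∈V y∈V x∈W y∈W = _ , _ , x≢y , x∈p∩q⁺ (x∈V , x∈W) , x∈p∩q⁺ (y∈V , y∈W)

    ∪Δ-clique : ∀ {W : Subset n} {x y} → x ≢ y → x ∈ W → y ∈ W → x ∈ Δ → y ∈ Δ → IsClique m W →
                IsClique (suc m) (W ∪ Δ)
    ∪Δ-clique x≢y x∈W y∈W x∈Δ y∈Δ cW = ∪-clique (shared x≢y x∈W y∈W x∈Δ y∈Δ) cW Δ-clique

    ∪Δ-shared : ∀ (V W : Subset n) → SharePair (V ∪ Δ) (W ∪ Δ)
    ∪Δ-shared V W = shared p≢q (q⊆p∪q V Δ p∈Δ) (q⊆p∪q V Δ q∈Δ) (q⊆p∪q W Δ p∈Δ) (q⊆p∪q W Δ q∈Δ)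

    U-clique : IsClique (suc (suc m)) U
    U-clique = clique-⊆ (∪-mono (p⊆p∪q Δ) (∪-mono (p⊆p∪q Δ) (p⊆p∪q Δ)))
      (∪₃-clique (∪-clique (∪Δ-shared X Y) XΔ YΔ) (∪-clique (∪Δ-shared Y Z) YΔ ZΔ) (∪-clique (∪Δ-shared Z X) ZΔ XΔ))
      where
      XΔ : IsClique (suc m) (X ∪ Δ)
      XΔ = ∪Δ-clique p≢q p∈X q∈X p∈Δ q∈Δ cX′
      YΔ : IsClique (suc m) (Y ∪ Δ)
      YΔ = ∪Δ-clique q≢r q∈Y r∈Y q∈Δ r∈Δ cY′
      ZΔ : IsClique (suc m) (Z ∪ Δ)
      ZΔ = ∪Δ-clique r≢p r∈Z p∈Z r∈Δ p∈Δ cZ′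

    r∉X : r ∉ X
    r∉X r∈X = proj₁ sparse (shared q≢r q∈X r∈X q∈Y r∈Y)

    ∣X∣<∣U∣ : ∣ X ∣ < ∣ U ∣
    ∣X∣<∣U∣ = p⊂q⇒∣p∣<∣q∣ (p⊆p∪q (Y ∪ Z) , r , q⊆p∪q X (Y ∪ Z) (p⊆p∪q Z r∈Y) , r∉X)

    small⊆Δ : ∀ {W : Subset n} {x y} → x ≢ y → x ∈ W → y ∈ W → x ∈ Δ → y ∈ Δ → ¬ 3 ≤ ∣ W ∣ → W ⊆ Δ
    small⊆Δ x≢y x∈W y∈W x∈Δ y∈Δ ¬3≤∣W∣ z∈W with ∣p∣≤2⇒pair x≢y x∈W y∈W (s≤s⁻¹ (≰⇒> ¬3≤∣W∣)) z∈W
    ... | inj₁ refl = x∈Δ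
    ... | inj₂ refl = y∈Δ

    small-time : ∀ {W : Subset n} → ¬ 3 ≤ ∣ W ∣ → ∣ W ∣ ∸ 3 ≡ 0
    small-time ¬3≤∣W∣ = m≤n⇒m∸n≡0 (≤-trans (s≤s⁻¹ (≰⇒> ¬3≤∣W∣)) (n≤1+n 2))

    noneBig : ¬ 3 ≤ ∣ X ∣ → ¬ 3 ≤ ∣ Y ∣ → ¬ 3 ≤ ∣ Z ∣ → Cluster U
    noneBig sX sY sZ =
      clique-mono (≤-trans (≤-reflexive m≡0) z≤n)
        (clique-⊆ (∪-least (small⊆Δ p≢q p∈X q∈X p∈Δ q∈Δ sX)
                   (∪-least (small⊆Δ q≢r q∈Y r∈Y q∈Δ r∈Δ sY) (small⊆Δ r≢p r∈Z p∈Z r∈Δ p∈Δ sZ)))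
                  Δ-clique)
      where
      m≡0 : m ≡ 0
      m≡0 = cong₂ _⊔_ (small-time {X} sX) (cong₂ _⊔_ (small-time {Y} sY) (small-time {Z} sZ))

    oneBig : 3 ≤ ∣ X ∣ → ¬ 3 ≤ ∣ Y ∣ → ¬ 3 ≤ ∣ Z ∣ → Cluster U
    oneBig bX sY sZ =
      clique-mono (≤-trans (s≤s m≤tX) (∸-monoˡ-< ∣X∣<∣U∣ bX))
        (clique-⊆ (∪-mono ⊆-refl (∪-least (small⊆Δ q≢r q∈Y r∈Y q∈Δ r∈Δ sY) (small⊆Δ r≢p r∈Z p∈Z r∈Δ p∈Δ sZ)))
                  (∪Δ-clique p≢q p∈X q∈X p∈Δ q∈Δ cX′))
      where
      m≤tX : m ≤ tX
      m≤tX = ⊔-lub ≤-refl (⊔-lub (≤-trans (≤-reflexive (small-time {Y} sY)) z≤n)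
                                 (≤-trans (≤-reflexive (small-time {Z} sZ)) z≤n))

    twoBig : 3 ≤ ∣ X ∣ → 3 ≤ ∣ Y ∣ → Cluster U
    twoBig bX bY =
      clique-mono (⊔-lub (∸3-+2 {∣ X ∣} 5≤∣U∣ (λ _ → ∣X∣+2≤∣U∣))
                         (⊔-lub (∸3-+2 {∣ Y ∣} 5≤∣U∣ (λ _ → ∣Y∣+2≤∣U∣)) (∸3-+2 {∣ Z ∣} 5≤∣U∣ ∣Z∣+2≤∣U∣)))
                  U-clique
      where
      X∪Y⊆U : X ∪ Y ⊆ U
      X∪Y⊆U = ∪-mono ⊆-refl (p⊆p∪q Z)
      Y∪X⊆U : Y ∪ X ⊆ U
      Y∪X⊆U = ∪-least (q⊆p∪q X (Y ∪ Z) ∘ p⊆p∪q Z) (p⊆p∪q (Y ∪ Z))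
      Z∪X⊆U : Z ∪ X ⊆ U
      Z∪X⊆U = ∪-least (q⊆p∪q X (Y ∪ Z) ∘ q⊆p∪q Y Z) (p⊆p∪q (Y ∪ Z))
      ∣X∣+2≤∣U∣ : ∣ X ∣ + 2 ≤ ∣ U ∣
      ∣X∣+2≤∣U∣ = ≤-trans (∣p∣+2≤∣p∪q∣ (proj₁ sparse) bY) (p⊆q⇒∣p∣≤∣q∣ X∪Y⊆U)
      ∣Y∣+2≤∣U∣ : ∣ Y ∣ + 2 ≤ ∣ U ∣
      ∣Y∣+2≤∣U∣ = ≤-trans (∣p∣+2≤∣p∪q∣ (proj₁ sparse ∘ SharePair-sym) bX)
                          (p⊆q⇒∣p∣≤∣q∣ Y∪X⊆U)
      ∣Z∣+2≤∣U∣ : 3 ≤ ∣ Z ∣ → ∣ Z ∣ + 2 ≤ ∣ U ∣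
      ∣Z∣+2≤∣U∣ bZ = ≤-trans (∣p∣+2≤∣p∪q∣ (proj₂ (proj₂ sparse)) bX)
                             (p⊆q⇒∣p∣≤∣q∣ Z∪X⊆U)
      5≤∣U∣ : 5 ≤ ∣ U ∣
      5≤∣U∣ = ≤-trans (+-monoˡ-≤ 2 bX) ∣X∣+2≤∣U∣

  cluster-rotate : ∀ {X Y Z} → Cluster (Y ∪ Z ∪ X) → Cluster (X ∪ Y ∪ Z)
  cluster-rotate {X} {Y} {Z} = subst Cluster (∪-rotate X Y Z)

  ∪₃-cluster : ∀ {X Y Z} → NoSharedPairs X Y Z → Triangle X Y Z → Cluster X → Cluster Y → Cluster Z →
               Cluster (X ∪ Y ∪ Z)
  ∪₃-cluster {X} {Y} {Z} sp T cX cY cZ = by-sizes (3 ≤? ∣ X ∣) (3 ≤? ∣ Y ∣) (3 ≤? ∣ Z ∣)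
    where
    module M = TriangleMerge sp T cX cY cZ
    module M′ = TriangleMerge (rotate-NoSharedPairs sp) (rotate T) cY cZ cX
    module M″ = TriangleMerge (rotate-NoSharedPairs (rotate-NoSharedPairs sp)) (rotate (rotate T)) cZ cX cY
    rotated² : Cluster (Z ∪ X ∪ Y) → Cluster (X ∪ Y ∪ Z)
    rotated² = cluster-rotate {X} ∘ cluster-rotate
    by-sizes : Dec (3 ≤ ∣ X ∣) → Dec (3 ≤ ∣ Y ∣) → Dec (3 ≤ ∣ Z ∣) → Cluster (X ∪ Y ∪ Z)
    by-sizes (yes bX) (yes bY) _        = M.twoBig bX bY
    by-sizes (no _)   (yes bY) (yes bZ) = cluster-rotate (M′.twoBig bY bZ)
    by-sizes (yes bX) (no _)   (yes bZ) = rotated² (M″.twoBig bZ bX)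
    by-sizes (yes bX) (no sY)  (no sZ)  = M.oneBig bX sY sZ
    by-sizes (no sX)  (yes bY) (no sZ)  = cluster-rotate (M′.oneBig bY sZ sX)
    by-sizes (no sX)  (no sY)  (yes bZ) = rotated² (M″.oneBig bZ sX sY)
    by-sizes (no sX)  (no sY)  (no sZ)  = M.noneBig sX sY sZ

-- Weighted families of clusters

-- Truncated subtraction gives ∅ weight 0, so a family keeps the clusters it absorbed as ∅.
weight : Subset n → ℕ
weight X = 2 * ∣ X ∣ ∸ 3

weight-∅ : weight (∅ {n}) ≡ 0
weight-∅ {n} = cong (λ c → 2 * c ∸ 3) (∣⊥∣≡0 n)

weight+3 : ∀ (X : Subset n) → 2 ≤ ∣ X ∣ → weight X + 3 ≡ 2 * ∣ X ∣
weight+3 _ 2≤∣X∣ = m∸n+n≡m (≤-trans (s≤s (s≤s (s≤s z≤n))) (*-monoʳ-≤ 2 2≤∣X∣))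

weight-∪ : ∀ {X Y : Subset n} → SharePair X Y → weight (X ∪ Y) ≤ weight X + weight Y
weight-∪ {X = X} {Y} XY@(x , y , x≢y , x∈X∩Y , y∈X∩Y) = ∸3-≤ (begin
  2 * ∣ X ∪ Y ∣ + 3                 ≤⟨ +-monoʳ-≤ (2 * ∣ X ∪ Y ∣) (n≤1+n 3) ⟩
  2 * ∣ X ∪ Y ∣ + 4                 ≡⟨ sym (*-distribˡ-+ 2 ∣ X ∪ Y ∣ 2) ⟩
  2 * (∣ X ∪ Y ∣ + 2)               ≤⟨ *-monoʳ-≤ 2 (∣p∪q∣+2≤∣p∣+∣q∣ XY) ⟩
  2 * (∣ X ∣ + ∣ Y ∣)               ≡⟨ *-distribˡ-+ 2 ∣ X ∣ ∣ Y ∣ ⟩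
  2 * ∣ X ∣ + 2 * ∣ Y ∣             ≡⟨ cong₂ _+_ (sym (weight+3 X 2≤∣X∣)) (sym (weight+3 Y 2≤∣Y∣)) ⟩
  (weight X + 3) + (weight Y + 3)   ≡⟨ +3+3 (weight X) (weight Y) ⟩
  weight X + weight Y + 6           ∎)
  where
  open ≤-Reasoning
  2≤∣X∣ : 2 ≤ ∣ X ∣
  2≤∣X∣ = distinct⇒2≤∣p∣ x≢y (proj₁ (x∈p∩q⁻ X Y x∈X∩Y)) (proj₁ (x∈p∩q⁻ X Y y∈X∩Y))
  2≤∣Y∣ : 2 ≤ ∣ Y ∣
  2≤∣Y∣ = distinct⇒2≤∣p∣ x≢y (proj₂ (x∈p∩q⁻ X Y x∈X∩Y)) (proj₂ (x∈p∩q⁻ X Y y∈X∩Y))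
  +3+3 : ∀ a b → (a + 3) + (b + 3) ≡ (a + b) + 6
  +3+3 = solve-∀

weight-∪₃ : ∀ {X Y Z : Subset n} → Triangle X Y Z → weight (X ∪ Y ∪ Z) ≤ weight X + (weight Y + weight Z)
weight-∪₃ {X = X} {Y} {Z} T@(triangle p≢q q≢r r≢p p∈Z p∈X q∈X q∈Y r∈Y r∈Z) = ∸3-≤ (+-cancelʳ-≤ 3 _ _ (begin
  2 * ∣ U ∣ + 3 + 3                 ≡⟨ +-assoc (2 * ∣ U ∣) 3 3 ⟩
  2 * ∣ U ∣ + 6                     ≡⟨ sym (*-distribˡ-+ 2 ∣ U ∣ 3) ⟩
  2 * (∣ U ∣ + 3)                   ≤⟨ *-monoʳ-≤ 2 (∣p∪q∪r∣+3≤∣p∣+∣q∣+∣r∣ T) ⟩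
  2 * (∣ X ∣ + (∣ Y ∣ + ∣ Z ∣))     ≡⟨ trans (*-distribˡ-+ 2 ∣ X ∣ _) (cong (2 * ∣ X ∣ +_) (*-distribˡ-+ 2 ∣ Y ∣ ∣ Z ∣)) ⟩
  2 * ∣ X ∣ + (2 * ∣ Y ∣ + 2 * ∣ Z ∣)
      ≡⟨ cong₂ _+_ (sym (weight+3 X (distinct⇒2≤∣p∣ p≢q p∈X q∈X)))
                   (cong₂ _+_ (sym (weight+3 Y (distinct⇒2≤∣p∣ q≢r q∈Y r∈Y)))
                              (sym (weight+3 Z (distinct⇒2≤∣p∣ r≢p r∈Z p∈Z)))) ⟩
  (weight X + 3) + ((weight Y + 3) + (weight Z + 3))
      ≡⟨ +3+3+3 (weight X) (weight Y) (weight Z) ⟩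
  weight X + (weight Y + weight Z) + 6 + 3 ∎))
  where
  open ≤-Reasoning
  U : Subset _
  U = X ∪ Y ∪ Z
  +3+3+3 : ∀ a b c → (a + 3) + ((b + 3) + (c + 3)) ≡ (a + (b + c)) + 6 + 3
  +3+3+3 = solve-∀

Family : ℕ → ℕ → Set
Family n k = Vector (Subset n) k

Covered : ∀ {k} → Family n k → Fin n → Fin n → Set
Covered F a b = ∃ λ i → a ∈ F i × b ∈ F i

Covered-sym : ∀ {k} {F : Family n k} {a b} → Covered F a b → Covered F b a
Covered-sym (i , a∈ , b∈) = i , b∈ , a∈

absorb : ∀ {k} → Family n k → Fin k → Fin k → Family n k
absorb F i j = updateAt (updateAt F j (const ∅)) i (const (F i ∪ F j))

absorb₂ : ∀ {k} → Family n k → Fin k → Fin k → Fin k → Family n k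
absorb₂ F i j l = absorb (absorb F j l) i j

module _ {k} {F : Family n k} {i j : Fin k} (i≢j : i ≢ j) where

  absorb-target : absorb F i j i ≡ F i ∪ F j
  absorb-target = updateAt-updates i (updateAt F j (const ∅))

  absorb-source : absorb F i j j ≡ ∅
  absorb-source = trans (updateAt-minimal j i _ (i≢j ∘ sym)) (updateAt-updates j F)

  absorb-other : ∀ {l} → l ≢ i → l ≢ j → absorb F i j l ≡ F l
  absorb-other l≢i l≢j = trans (updateAt-minimal _ i _ l≢i) (updateAt-minimal _ j F l≢j)

  absorb-off-target : ∀ l → l ≢ i → absorb F i j l ≡ ∅ ⊎ absorb F i j l ≡ F l
  absorb-off-target l l≢i with l ≟ᶠ j
  ... | yes refl = inj₁ absorb-source
  ... | no l≢j = inj₂ (absorb-other l≢i l≢j)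

  sum-absorb : ∀ (w : Subset n → ℕ) → w ∅ ≡ 0 →
               sum (w ∘ absorb F i j) + (w (F i) + w (F j)) ≡ sum (w ∘ F) + w (F i ∪ F j)
  sum-absorb w w∅≡0 = begin
    sum (w ∘ absorb F i j) + (w (F i) + w (F j))    ≡⟨ sym (+-assoc (sum (w ∘ absorb F i j)) (w (F i)) (w (F j))) ⟩
    sum (w ∘ absorb F i j) + w (F i) + w (F j)      ≡⟨ cong (λ X → sum (w ∘ absorb F i j) + w X + w (F j)) (sym F′i≡Fi) ⟩
    sum (w ∘ absorb F i j) + w (F′ i) + w (F j)     ≡⟨ cong (_+ w (F j)) (sum-updateAt w F′ i (const (F i ∪ F j))) ⟩
    sum (w ∘ F′) + w (F i ∪ F j) + w (F j)          ≡⟨ +-assoc (sum (w ∘ F′)) _ _ ⟩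
    sum (w ∘ F′) + (w (F i ∪ F j) + w (F j))        ≡⟨ cong (sum (w ∘ F′) +_) (+-comm (w (F i ∪ F j)) _) ⟩
    sum (w ∘ F′) + (w (F j) + w (F i ∪ F j))        ≡⟨ sym (+-assoc (sum (w ∘ F′)) _ _) ⟩
    sum (w ∘ F′) + w (F j) + w (F i ∪ F j)          ≡⟨ cong (_+ w (F i ∪ F j)) (sum-updateAt w F j (const ∅)) ⟩
    sum (w ∘ F) + w ∅ + w (F i ∪ F j)               ≡⟨ cong (λ z → sum (w ∘ F) + z + w (F i ∪ F j)) w∅≡0 ⟩
    sum (w ∘ F) + 0 + w (F i ∪ F j)                 ≡⟨ cong (_+ w (F i ∪ F j)) (+-identityʳ _) ⟩
    sum (w ∘ F) + w (F i ∪ F j)                     ∎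
    where
    open ≡-Reasoning
    F′ : Family n k
    F′ = updateAt F j (const ∅)
    F′i≡Fi : F′ i ≡ F i
    F′i≡Fi = updateAt-minimal i j F i≢j

  ∈-absorb-target : ∀ {a} → a ∈ F i ∪ F j → a ∈ absorb F i j i
  ∈-absorb-target {a} = subst (a ∈_) (sym absorb-target)

  Covered-absorb : ∀ {a b} → Covered F a b → Covered (absorb F i j) a b
  Covered-absorb {a} {b} (l , a∈ , b∈) with l ≟ᶠ i | l ≟ᶠ j
  ... | yes refl | _ = i , ∈-absorb-target (p⊆p∪q (F j) a∈) , ∈-absorb-target (p⊆p∪q (F j) b∈)
  ... | no _ | yes refl = i , ∈-absorb-target (q⊆p∪q (F i) _ a∈) , ∈-absorb-target (q⊆p∪q (F i) _ b∈)
  ... | no l≢i | no l≢j = l , subst (a ∈_) (sym (absorb-other l≢i l≢j)) a∈ , subst (b ∈_) (sym (absorb-other l≢i l≢j)) b∈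

module _ {k} {F : Family n k} {i j l : Fin k} (i≢j : i ≢ j) (j≢l : j ≢ l) (l≢i : l ≢ i) where

  absorb₂-merged : absorb F j l i ∪ absorb F j l j ≡ F i ∪ F j ∪ F l
  absorb₂-merged = cong₂ _∪_ (absorb-other j≢l i≢j (l≢i ∘ sym)) (absorb-target j≢l)

  sum-absorb₂ : ∀ (w : Subset n → ℕ) → w ∅ ≡ 0 →
                sum (w ∘ absorb₂ F i j l) + (w (F i) + (w (F j) + w (F l))) ≡ sum (w ∘ F) + w (F i ∪ F j ∪ F l)
  sum-absorb₂ w w∅≡0 = +-cancelʳ-≡ (w V) _ _ (begin
    S″ + (w (F i) + (w (F j) + w (F l))) + w V   ≡⟨ swap₁ S″ (w (F i)) (w V) _ ⟩
    S″ + (w (F i) + w V) + (w (F j) + w (F l))   ≡⟨ cong (_+ (w (F j) + w (F l))) outer ⟩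
    S′ + w U + (w (F j) + w (F l))               ≡⟨ swap₂ S′ (w U) _ ⟩
    S′ + (w (F j) + w (F l)) + w U               ≡⟨ cong (_+ w U) (sum-absorb j≢l w w∅≡0) ⟩
    S + w V + w U                                ≡⟨ swap₂ S (w V) (w U) ⟩
    S + w U + w V                                ∎)
    where
    open ≡-Reasoning
    F′ : Family n k
    F′ = absorb F j l
    S″ S′ S : ℕ
    S″ = sum (w ∘ absorb₂ F i j l)
    S′ = sum (w ∘ F′)
    S = sum (w ∘ F)
    V U : Subset n
    V = F j ∪ F l
    U = F i ∪ V
    swap₁ : ∀ a b c d → a + (b + d) + c ≡ a + (b + c) + d
    swap₁ = solve-∀
    swap₂ : ∀ a b c → a + b + c ≡ a + c + b
    swap₂ = solve-∀
    outer : S″ + (w (F i) + w V) ≡ S′ + w U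
    outer = subst₂ (λ X Y → S″ + (w X + w Y) ≡ S′ + w (X ∪ Y))
                   (absorb-other j≢l i≢j (l≢i ∘ sym)) (absorb-target j≢l) (sum-absorb i≢j w w∅≡0)

module Clusterings (G : Graph n) (e : ℕ) {k : ℕ} where

  record Clustering (F : Family n k) : Set where
    field
      cluster : ∀ i → Cluster G (F i)
      weight≤ : sum (weight ∘ F) ≤ e
      covers  : ∀ {a b} → adj G a b ≡ true → Covered F a b

  size : Family n k → ℕ
  size F = sum (∣_∣ ∘ F)

  MergeablePair : Family n k → Set
  MergeablePair F = ∃₂ λ i j → i ≢ j × SharePair (F i) (F j)

  MergeableTriple : Family n k → Set
  MergeableTriple F = ∃ λ i → ∃₂ λ j l → i ≢ j × j ≢ l × l ≢ i × Triangle (F i) (F j) (F l)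

  cluster-absorb : ∀ {F : Family n k} {i j} (i≢j : i ≢ j) → Cluster G (F i ∪ F j) →
                   (∀ l → l ≢ i → l ≢ j → Cluster G (F l)) → ∀ l → Cluster G (absorb F i j l)
  cluster-absorb {F} {i} {j} i≢j cU cF l with l ≟ᶠ i | l ≟ᶠ j
  ... | yes refl | _ = subst (Cluster G) (sym (absorb-target i≢j)) cU
  ... | no _ | yes refl = subst (Cluster G) (sym (absorb-source i≢j)) (∅-clique G)
  ... | no l≢i | no l≢j = subst (Cluster G) (sym (absorb-other i≢j l≢i l≢j)) (cF l l≢i l≢j)

  module _ {F : Family n k} (cF : Clustering F) where
    open Clustering cF

    merge-pair : ∀ {i j} → i ≢ j → SharePair (F i) (F j) → Clustering (absorb F i j) × size (absorb F i j) < size F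
    merge-pair {i} {j} i≢j XY =
      record
        { cluster = cluster-absorb i≢j (∪-cluster G XY (cluster i) (cluster j)) (λ l _ _ → cluster l)
        ; weight≤ = ≤-trans (+≡+⇒≤ (sum-absorb i≢j weight (weight-∅ {n})) (weight-∪ XY)) weight≤
        ; covers  = Covered-absorb i≢j ∘ covers
        } ,
      +≡+⇒< (sum-absorb i≢j ∣_∣ (∣⊥∣≡0 n)) (<-≤-trans (m<m+n _ z<s) (∣p∪q∣+2≤∣p∣+∣q∣ XY))

    merge-triple : ∀ {i j l} → ¬ MergeablePair F → (i≢j : i ≢ j) (j≢l : j ≢ l) (l≢i : l ≢ i) → Triangle (F i) (F j) (F l) →
             Clustering (absorb₂ F i j l) × size (absorb₂ F i j l) < size F
    merge-triple {i} {j} {l} ¬pair i≢j j≢l l≢i T =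
      record
        { cluster = cluster-absorb i≢j (subst (Cluster G) (sym (absorb₂-merged i≢j j≢l l≢i)) cU) cF′
        ; weight≤ = ≤-trans (+≡+⇒≤ (sum-absorb₂ i≢j j≢l l≢i weight (weight-∅ {n})) (weight-∪₃ T)) weight≤
        ; covers  = Covered-absorb i≢j ∘ Covered-absorb j≢l ∘ covers
        } ,
      +≡+⇒< (sum-absorb₂ i≢j j≢l l≢i ∣_∣ (∣⊥∣≡0 n)) (<-≤-trans (m<m+n _ z<s) (∣p∪q∪r∣+3≤∣p∣+∣q∣+∣r∣ T))
      where
      sparse : NoSharedPairs (F i) (F j) (F l)
      sparse = (λ XY → ¬pair (i , j , i≢j , XY)) , (λ YZ → ¬pair (j , l , j≢l , YZ)) , (λ ZX → ¬pair (l , i , l≢i , ZX))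
      cU : Cluster G (F i ∪ F j ∪ F l)
      cU = ∪₃-cluster G sparse T (cluster i) (cluster j) (cluster l)
      cF′ : ∀ m → m ≢ i → m ≢ j → Cluster G (absorb F j l m)
      cF′ m m≢i m≢j with absorb-off-target j≢l m m≢j
      ... | inj₁ eq = subst (Cluster G) (sym eq) (∅-clique G)
      ... | inj₂ eq = subst (Cluster G) (sym eq) (cluster m)

  mergeablePair? : ∀ F → Dec (MergeablePair F)
  mergeablePair? F = any? λ i → any? λ j → ¬? (i ≟ᶠ j) ×-dec sharePair? (F i) (F j)

  mergeableTriple? : ∀ F → Dec (MergeableTriple F)
  mergeableTriple? F = any? λ i → any? λ j → any? λ l →
    ¬? (i ≟ᶠ j) ×-dec ¬? (j ≟ᶠ l) ×-dec ¬? (l ≟ᶠ i) ×-dec triangle? (F i) (F j) (F l)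

  Stable : Family n k → Set
  Stable F = ¬ MergeablePair F × ¬ MergeableTriple F

  stabilise : ∀ {F} → Clustering F → ∃ λ F′ → Clustering F′ × Stable F′
  stabilise {F} cF = go cF (<-wellFounded (size F))
    where
    go : ∀ {F} → Clustering F → Acc _<_ (size F) → ∃ λ F′ → Clustering F′ × Stable F′
    go {F} cF (acc rec) with mergeablePair? F
    ... | yes (i , j , i≢j , XY) = let cF′ , smaller = merge-pair cF i≢j XY in go cF′ (rec smaller)
    ... | no ¬pair with mergeableTriple? F
    ...   | yes (i , j , l , i≢j , j≢l , l≢i , T) =
      let cF′ , smaller = merge-triple cF ¬pair i≢j j≢l l≢i T in go cF′ (rec smaller)
    ...   | no ¬triple = F , cF , ¬pair , ¬triple

  module _ {F} (cF : Clustering F) (stable : Stable F) where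
    open Clustering cF

    triangle-covered : ∀ {u w x} → u ≢ w → w ≢ x → x ≢ u → Covered F u w → Covered F w x → Covered F x u →
                       ∃ λ i → u ∈ F i × w ∈ F i × x ∈ F i
    triangle-covered u≢w w≢x x≢u (A , u∈A , w∈A) (B , w∈B , x∈B) (C , x∈C , u∈C) with A ≟ᶠ B | B ≟ᶠ C | C ≟ᶠ A
    ... | yes refl | _ | _ = A , u∈A , w∈A , x∈B
    ... | _ | yes refl | _ = B , u∈C , w∈B , x∈B
    ... | _ | _ | yes refl = A , u∈A , w∈A , x∈C
    ... | no A≢B | no B≢C | no C≢A =
      contradiction (A , B , C , A≢B , B≢C , C≢A , triangle u≢w w≢x x≢u u∈C u∈A w∈A w∈B x∈B x∈C) (proj₂ stable)

    -- The triangles a w x and b w x each lie in one cluster; sharing w x, these coincide.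
    Step-covered : ∀ s {a b} → Step G s a b → Covered F a b
    Step-covered zero ab = covers ab
    Step-covered (suc s) (inj₁ ab) = Step-covered s ab
    Step-covered (suc s) (inj₂ (w , x , a≢b , a≢w , a≢x , b≢w , b≢x , w≢x , aw , ax , bw , bx , wx))
      with triangle-covered a≢w w≢x (a≢x ∘ sym) (Step-covered s aw) (Step-covered s wx) (Covered-sym (Step-covered s ax))
         | triangle-covered b≢w w≢x (b≢x ∘ sym) (Step-covered s bw) (Step-covered s wx) (Covered-sym (Step-covered s bx))
    ... | D , a∈D , w∈D , x∈D | E , b∈E , w∈E , x∈E with D ≟ᶠ E
    ... | yes refl = D , a∈D , b∈E
    ... | no D≢E = contradiction (D , E , D≢E , _ , _ , w≢x , x∈p∩q⁺ (w∈D , w∈E) , x∈p∩q⁺ (x∈D , x∈E)) (proj₁ stable)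

    final : ∀ {t} → e ≤ 2 * t + 2 → IsFinal G (t ∸ 1)
    final {t} e≤2t+2 s a b ab with Step-covered s ab
    ... | i , a∈ , b∈ =
      Step-mono G (weight≤⇒time≤ {∣ F i ∣} {t} (≤-trans (≤-sum (weight ∘ F) i) (≤-trans weight≤ e≤2t+2)))
                (cluster i a∈ b∈ (Step-irrefl G s ab))

module _ (G : Graph n) where

  isEdge< : Fin n → Fin n → Bool
  isEdge< u v = ⌊ toℕ u <? toℕ v ⌋ ∧ adj G u v

  edgeCount≡ : edgeCount G ≡ sum (λ u → sum (λ v → if isEdge< u v then 1 else 0))
  edgeCount≡ = trans (sum-map-allFin (λ u → List.sum (map (χ u) (allFin n)))) (sum-cong-≗ (λ u → sum-map-allFin (χ u)))
    where
    χ : Fin n → Fin n → ℕ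
    χ u v = if isEdge< u v then 1 else 0

  edgeSet : Fin n → Fin n → Subset n
  edgeSet u v = if isEdge< u v then ⁅ u ⁆ ∪ ⁅ v ⁆ else ∅

  edgeSet-cluster : ∀ u v → Cluster G (edgeSet u v)
  edgeSet-cluster u v = go (isEdge< u v) refl
    where
    go : ∀ b → isEdge< u v ≡ b → Cluster G (if b then ⁅ u ⁆ ∪ ⁅ v ⁆ else ∅)
    go true  uv = clique-mono G z≤n (pair-clique G (∧-conicalʳ _ _ uv))
    go false _  = ∅-clique G

  weight-edgeSet : ∀ u v → weight (edgeSet u v) ≤ (if isEdge< u v then 1 else 0)
  weight-edgeSet u v with isEdge< u v
  ... | true  = ∸-monoˡ-≤ 3 (*-monoʳ-≤ 2 ∣uv∣≤2)
    where
    ∣uv∣≤2 : ∣ ⁅ u ⁆ ∪ ⁅ v ⁆ ∣ ≤ 2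
    ∣uv∣≤2 = ≤-trans (∣p∪q∣≤∣p∣+∣q∣ ⁅ u ⁆ ⁅ v ⁆) (≤-reflexive (cong₂ _+_ (∣⁅x⁆∣≡1 u) (∣⁅x⁆∣≡1 v)))
  ... | false = ≤-reflexive (weight-∅ {n})

  ∈-edgeSet : ∀ {u v} → toℕ u < toℕ v → adj G u v ≡ true → u ∈ edgeSet u v × v ∈ edgeSet u v
  ∈-edgeSet {u} {v} u<v uv = subst (λ X → u ∈ X × v ∈ X) (sym edgeSet≡) (p⊆p∪q ⁅ v ⁆ (x∈⁅x⁆ u) , q⊆p∪q ⁅ u ⁆ ⁅ v ⁆ (x∈⁅x⁆ v))
    where
    edgeSet≡ : (if ⌊ toℕ u <? toℕ v ⌋ ∧ adj G u v then ⁅ u ⁆ ∪ ⁅ v ⁆ else ∅) ≡ ⁅ u ⁆ ∪ ⁅ v ⁆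
    edgeSet≡ with toℕ u <? toℕ v
    ... | yes _ rewrite uv = refl
    ... | no u≮v = contradiction u<v u≮v

  -- Indexed by the pairs (u, v), so that its weight is the double sum defining edgeCount.
  edgeClusters : Family n (n * n)
  edgeClusters i = uncurry edgeSet (remQuot {n} n i)

  edgeClusters-combine : ∀ u v → edgeClusters (combine {n} {n} u v) ≡ edgeSet u v
  edgeClusters-combine u v = cong (uncurry edgeSet) (remQuot-combine u v)

  open Clusterings G (edgeCount G)

  edgeClustering : Clustering edgeClusters
  edgeClustering = record
    { cluster = λ i → edgeSet-cluster (proj₁ (remQuot {n} n i)) (proj₂ (remQuot {n} n i))
    ; weight≤ = begin
        sum (weight ∘ edgeClusters)                             ≡⟨ sum-combine n n (weight ∘ edgeClusters) ⟩
        sum (λ u → sum (λ v → weight (edgeClusters (combine {n} {n} u v))))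
          ≡⟨ sum-cong-≗ (λ u → sum-cong-≗ (λ v → cong weight (edgeClusters-combine u v))) ⟩
        sum (λ u → sum (λ v → weight (edgeSet u v)))            ≤⟨ sum-mono (λ u → sum-mono (weight-edgeSet u)) ⟩
        sum (λ u → sum (λ v → if isEdge< u v then 1 else 0))    ≡⟨ sym edgeCount≡ ⟩
        edgeCount G                                             ∎
    ; covers = covers
    }
    where
    open ≤-Reasoning
    covered : ∀ {u v} → toℕ u < toℕ v → adj G u v ≡ true → Covered edgeClusters u v
    covered {u} {v} u<v uv =
      combine u v , subst (λ X → u ∈ X × v ∈ X) (sym (edgeClusters-combine u v)) (∈-edgeSet u<v uv)
    covers : ∀ {a b} → adj G a b ≡ true → Covered edgeClusters a b
    covers {a} {b} ab with <-cmp (toℕ a) (toℕ b)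
    ... | tri< a<b _ _ = covered a<b ab
    ... | tri≈ _ a≡b _ = contradiction (toℕ-injective a≡b) (Step-irrefl G 0 ab)
    ... | tri> _ _ b<a = Covered-sym (covered b<a (trans (adj-sym G b a) ab))

module _ (G : Graph n) where
  open Clusterings G (edgeCount G)

  edgeCount≤⇒final : ∀ t → edgeCount G ≤ 2 * t + 2 → IsFinal G (t ∸ 1)
  edgeCount≤⇒final t with stabilise (edgeClustering G)
  ... | _ , cF , stable = final cF stable {t}

  2τ+3≤edgeCount : ∀ {t} → SatTime G t → 1 ≤ t → 2 * t + 3 ≤ edgeCount G
  2τ+3≤edgeCount {t} (_ , earliest) 1≤t with 2 * t + 3 ≤? edgeCount G
  ... | yes 2t+3≤e = 2t+3≤e
  ... | no 2t+3≰e = contradiction (edgeCount≤⇒final t e≤2t+2) (earliest (t ∸ 1) (∸-monoʳ-< z<s 1≤t))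
    where
    e≤2t+2 : edgeCount G ≤ 2 * t + 2
    e≤2t+2 = s≤s⁻¹ (subst (edgeCount G <_) (+-suc (2 * t) 2) (≰⇒> 2t+3≰e))

-- The family H_t

Complete : Graph n → ℕ → Set
Complete G s = ∀ {a b} → a ≢ b → Step G s a b

pigeonhole₃ : ∀ {A : Set} {x y a b c : A} → a ≢ b → a ≢ c → b ≢ c →
              a ≡ x ⊎ a ≡ y → b ≡ x ⊎ b ≡ y → c ≡ x ⊎ c ≡ y → ⊥
pigeonhole₃ a≢b _ _ (inj₁ refl) (inj₁ refl) _ = a≢b refl
pigeonhole₃ a≢b _ _ (inj₂ refl) (inj₂ refl) _ = a≢b refl
pigeonhole₃ _ a≢c _ (inj₁ refl) _ (inj₁ refl) = a≢c refl
pigeonhole₃ _ a≢c _ (inj₂ refl) _ (inj₂ refl) = a≢c refl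
pigeonhole₃ _ _ b≢c _ (inj₁ refl) (inj₁ refl) = b≢c refl
pigeonhole₃ _ _ b≢c _ (inj₂ refl) (inj₂ refl) = b≢c refl

module Extension {m} (H : Graph (suc m)) where

  K : Graph m
  K = restrict H

  v : Fin (suc m)
  v = fromℕ m

  Step-inject₁ : ∀ s {a b} → Step K s a b → Step H s (inject₁ a) (inject₁ b)
  Step-inject₁ zero ab = ab
  Step-inject₁ (suc s) (inj₁ ab) = inj₁ (Step-inject₁ s ab)
  Step-inject₁ (suc s) (inj₂ (w , x , a≢b , a≢w , a≢x , b≢w , b≢x , w≢x , aw , ax , bw , bx , wx)) =
    inj₂ (inject₁ w , inject₁ x , a≢b ∘ inject₁-injective , a≢w ∘ inject₁-injective , a≢x ∘ inject₁-injective ,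
          b≢w ∘ inject₁-injective , b≢x ∘ inject₁-injective , w≢x ∘ inject₁-injective ,
          Step-inject₁ s aw , Step-inject₁ s ax , Step-inject₁ s bw , Step-inject₁ s bx , Step-inject₁ s wx)

  old-neighbour : ∀ {z} → adj H v z ≡ true → ∃ λ z′ → inject₁ z′ ≡ z
  old-neighbour {z} vz with view z
  ... | ‵fromℕ = contradiction (trans (sym vz) (irrefl H v)) (λ ())
  ... | ‵inject₁ z′ = z′ , refl

  module Attached {x y : Fin m} (x≢y : x ≢ y) (vx : adj H v (inject₁ x) ≡ true) (vy : adj H v (inject₁ y) ≡ true) where

    -- An old vertex u other than x, y spans with v, x, y a K4 minus vu.
    complete-new : ∀ {s} → Complete K s → ∀ u → Step H (suc s) v (inject₁ u)
    complete-new {s} cK u with u ≟ᶠ x | u ≟ᶠ y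
    ... | yes refl | _ = Step-mono H z≤n vx
    ... | no _ | yes refl = Step-mono H z≤n vy
    ... | no u≢x | no u≢y =
      inj₂ (inject₁ x , inject₁ y , fromℕ≢inject₁ , fromℕ≢inject₁ , fromℕ≢inject₁ ,
            u≢x ∘ inject₁-injective , u≢y ∘ inject₁-injective , x≢y ∘ inject₁-injective ,
            Step-mono H z≤n vx , Step-mono H z≤n vy ,
            Step-inject₁ s (cK u≢x) , Step-inject₁ s (cK u≢y) , Step-inject₁ s (cK x≢y))

    complete-extend : ∀ {s} → Complete K s → Complete H (suc s)
    complete-extend {s} cK {a} {b} a≢b with view a | view b
    ... | ‵fromℕ | ‵fromℕ = contradiction refl a≢b
    ... | ‵fromℕ | ‵inject₁ b′ = complete-new cK b′
    ... | ‵inject₁ a′ | ‵fromℕ = Step-sym H (suc s) (complete-new cK a′)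
    ... | ‵inject₁ a′ | ‵inject₁ b′ = inj₁ (Step-inject₁ s (cK (a≢b ∘ cong inject₁)))

    module _ (∣N[v]∣≤2 : ∣ neighbours H v ∣ ≤ 2) where

      neighbour⇒xy : ∀ {z} → adj H v z ≡ true → z ≡ inject₁ x ⊎ z ≡ inject₁ y
      neighbour⇒xy vz =
        ∣p∣≤2⇒pair (x≢y ∘ inject₁-injective) (∈-neighbours⁺ H vx) (∈-neighbours⁺ H vy) ∣N[v]∣≤2 (∈-neighbours⁺ H vz)

      -- A K4 minus an edge through v needs either the edge xy or a third neighbour of v.
      frozen : ∀ s → (∀ {s′} → s′ < s → ¬ Step K s′ x y) →
               (∀ {z} → Step H s v z → adj H v z ≡ true) × (∀ {a b} → Step H s (inject₁ a) (inject₁ b) → Step K s a b)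
      frozen zero _ = (λ vz → vz) , (λ ab → ab)
      frozen (suc s) x≁y with frozen s (x≁y ∘ m<n⇒m<1+n)
      ... | v-frozen , K-frozen = new , old
        where
        no-third : ∀ {a b c} → a ≢ b → a ≢ c → b ≢ c → Step H s v a → Step H s v b → Step H s v c → ⊥
        no-third a≢b a≢c b≢c va vb vc =
          pigeonhole₃ a≢b a≢c b≢c (neighbour⇒xy (v-frozen va)) (neighbour⇒xy (v-frozen vb)) (neighbour⇒xy (v-frozen vc))
        new : ∀ {z} → Step H (suc s) v z → adj H v z ≡ true
        new (inj₁ vz) = v-frozen vz
        new (inj₂ (a , b , _ , _ , _ , _ , _ , a≢b , va , vb , _ , _ , ab))
          with neighbour⇒xy (v-frozen va) | neighbour⇒xy (v-frozen vb)
        ... | inj₁ refl | inj₁ refl = contradiction refl a≢b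
        ... | inj₂ refl | inj₂ refl = contradiction refl a≢b
        ... | inj₁ refl | inj₂ refl = contradiction (K-frozen ab) (x≁y (n<1+n s))
        ... | inj₂ refl | inj₁ refl = contradiction (K-frozen (Step-sym H s ab)) (x≁y (n<1+n s))
        old : ∀ {a b} → Step H (suc s) (inject₁ a) (inject₁ b) → Step K (suc s) a b
        old (inj₁ ab) = inj₁ (K-frozen ab)
        old (inj₂ (c , d , a≢b , a≢c , a≢d , b≢c , b≢d , c≢d , ac , ad , bc , bd , cd)) with view c | view d
        ... | ‵fromℕ | _ = ⊥-elim (no-third a≢b a≢d b≢d (Step-sym H s ac) (Step-sym H s bc) cd)
        ... | ‵inject₁ _ | ‵fromℕ = ⊥-elim (no-third a≢b a≢c b≢c (Step-sym H s ad) (Step-sym H s bd) (Step-sym H s cd))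
        ... | ‵inject₁ c′ | ‵inject₁ d′ =
          inj₂ (c′ , d′ , a≢b ∘ cong inject₁ , a≢c ∘ cong inject₁ , a≢d ∘ cong inject₁ , b≢c ∘ cong inject₁ ,
                b≢d ∘ cong inject₁ , c≢d ∘ cong inject₁ ,
                K-frozen ac , K-frozen ad , K-frozen bc , K-frozen bd , K-frozen cd)

  edgeCount-extend : edgeCount H ≡ edgeCount K + degree H v
  edgeCount-extend = begin
    edgeCount H                                               ≡⟨ edgeCount≡ H ⟩
    sum (λ u → sum (χ H u))                                   ≡⟨ sum-init-last (λ u → sum (χ H u)) ⟩
    sum (λ u → sum (χ H (inject₁ u))) + sum (χ H v)           ≡⟨ cong₂ _+_ (sum-cong-≗ split-row) last-row ⟩
    sum (λ u → old-row u + χ H (inject₁ u) v) + 0             ≡⟨ +-identityʳ _ ⟩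
    sum (λ u → old-row u + χ H (inject₁ u) v)                 ≡⟨ ∑-distrib-+ old-row (λ u → χ H (inject₁ u) v) ⟩
    sum old-row + sum (λ u → χ H (inject₁ u) v)               ≡⟨ cong₂ _+_ (sum-cong-≗ old-row≡) (sum-cong-≗ to-v≡) ⟩
    sum (λ u → sum (χ K u)) + sum (λ u → N[v] (inject₁ u))    ≡⟨ cong₂ _+_ (sym (edgeCount≡ K)) (sym degree-v) ⟩
    edgeCount K + degree H v                                  ∎
    where
    open ≡-Reasoning
    χ : ∀ {k} → Graph k → Fin k → Fin k → ℕ
    χ G a b = if isEdge< G a b then 1 else 0
    N[v] : Fin (suc m) → ℕ
    N[v] w = if adj H v w then 1 else 0
    old-row : Fin m → ℕ
    old-row u = sum (λ w → χ H (inject₁ u) (inject₁ w))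
    split-row : ∀ u → sum (χ H (inject₁ u)) ≡ old-row u + χ H (inject₁ u) v
    split-row u = sum-init-last (χ H (inject₁ u))
    last-row : sum (χ H v) ≡ 0
    last-row = trans (sum-cong-≗ {suc m} from-v≡) (sum-replicate-zero (suc m))
      where
      from-v≡ : ∀ w → χ H v w ≡ 0
      from-v≡ w with toℕ v <? toℕ w
      ... | yes v<w = contradiction (≤-trans v<w (≤fromℕ w)) (<-irrefl refl)
      ... | no _ = refl
    old-row≡ : ∀ u → old-row u ≡ sum (χ K u)
    old-row≡ u = sum-cong-≗ old-old
      where
      old-old : ∀ w → χ H (inject₁ u) (inject₁ w) ≡ χ K u w
      old-old w rewrite toℕ-inject₁ u | toℕ-inject₁ w = refl
    to-v≡ : ∀ u → χ H (inject₁ u) v ≡ N[v] (inject₁ u)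
    to-v≡ u with toℕ (inject₁ u) <? toℕ v
    ... | yes _ rewrite adj-sym H (inject₁ u) v = refl
    ... | no u≮v = contradiction (subst₂ _<_ (sym (toℕ-inject₁ u)) (sym (toℕ-fromℕ m)) (toℕ<n u)) u≮v
    degree-v : degree H v ≡ sum (λ u → N[v] (inject₁ u))
    degree-v = begin
      degree H v                                ≡⟨ sum-map-allFin N[v] ⟩
      sum N[v]                                  ≡⟨ sum-init-last N[v] ⟩
      sum (λ u → N[v] (inject₁ u)) + N[v] v     ≡⟨ cong (λ b → sum (λ u → N[v] (inject₁ u)) + (if b then 1 else 0)) (irrefl H v) ⟩
      sum (λ u → N[v] (inject₁ u)) + 0          ≡⟨ +-identityʳ _ ⟩
      sum (λ u → N[v] (inject₁ u))              ∎

triangle-complete : (K : Graph 3) → IsH 0 K → Complete K 0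
triangle-complete K (h01 , h02 , h12) {zero}             {zero}             0≢0 = contradiction refl 0≢0
triangle-complete K (h01 , h02 , h12) {zero}             {suc zero}         _   = h01
triangle-complete K (h01 , h02 , h12) {zero}             {suc (suc zero)}   _   = h02
triangle-complete K (h01 , h02 , h12) {suc zero}         {zero}             _   = Step-sym K 0 h01
triangle-complete K (h01 , h02 , h12) {suc zero}         {suc zero}         1≢1 = contradiction refl 1≢1
triangle-complete K (h01 , h02 , h12) {suc zero}         {suc (suc zero)}   _   = h12
triangle-complete K (h01 , h02 , h12) {suc (suc zero)}   {zero}             _   = Step-sym K 0 h02
triangle-complete K (h01 , h02 , h12) {suc (suc zero)}   {suc zero}         _   = Step-sym K 0 h12
triangle-complete K (h01 , h02 , h12) {suc (suc zero)}   {suc (suc zero)}   2≢2 = contradiction refl 2≢2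

triangle-edgeCount : (K : Graph 3) → IsH 0 K → edgeCount K ≡ 3
triangle-edgeCount K (h01 , h02 , h12) rewrite h01 | h02 | h12 = refl

-- Below, H ∈ 𝓗_{t+1} lives on Fin (4 + t) and its newest vertex v_{t+1} is fromℕ (3 + t).
IsH-∣N∣≤2 : ∀ t (H : Graph (4 + t)) → IsH (suc t) H → ∣ neighbours H (fromℕ (3 + t)) ∣ ≤ 2
IsH-∣N∣≤2 zero H (_ , deg) = ≤-reflexive (trans (sym (degree≡∣neighbours∣ H _)) deg)
IsH-∣N∣≤2 (suc t) H (_ , _ , deg , _) = ≤-reflexive (trans (sym (degree≡∣neighbours∣ H _)) deg)

IsH-attached : ∀ t (H : Graph (4 + t)) → IsH (suc t) H →
               ∃₂ λ x y → x ≢ y × adj H (fromℕ (3 + t)) (inject₁ x) ≡ true × adj H (fromℕ (3 + t)) (inject₁ y) ≡ true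
IsH-attached zero H (_ , deg)
  with 2≤∣p∣⇒distinct (≤-reflexive (trans (sym deg) (degree≡∣neighbours∣ H _)))
... | a , b , a≢b , a∈N , b∈N
  with Extension.old-neighbour H (∈-neighbours⁻ H a∈N) | Extension.old-neighbour H (∈-neighbours⁻ H b∈N)
... | x , refl | y , refl = x , y , a≢b ∘ cong inject₁ , ∈-neighbours⁻ H a∈N , ∈-neighbours⁻ H b∈N
IsH-attached (suc t) H (_ , vx , _ , w , vw , w≢x , _) with Extension.old-neighbour H vw
... | y , refl = fromℕ (3 + t) , y , (λ x≡y → w≢x (cong inject₁ (sym x≡y))) , vx , vw

IsH-complete : ∀ t (H : Graph (4 + t)) → IsH (suc t) H → Complete H (suc t)
IsH-complete zero H hH@(hK , _) with IsH-attached zero H hH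
... | x , y , x≢y , vx , vy = Extension.Attached.complete-extend H x≢y vx vy (triangle-complete (restrict H) hK)
IsH-complete (suc t) H hH@(hK , _) with IsH-attached (suc t) H hH
... | x , y , x≢y , vx , vy = Extension.Attached.complete-extend H x≢y vx vy (IsH-complete t (restrict H) hK)

IsH-frozen : ∀ t (H : Graph (4 + t)) → IsH (suc t) H → ∀ {s z} → s ≤ t →
             Step H s (fromℕ (3 + t)) z → adj H (fromℕ (3 + t)) z ≡ true
IsH-frozen zero _ _ z≤n vz = vz
IsH-frozen (suc t) H hH@(hK , vx , _ , w , vw , w≢x , x≁w) {s} s≤1+t with Extension.old-neighbour H vw
... | y , refl = proj₁ (Extension.Attached.frozen H x≢y vx vw (IsH-∣N∣≤2 (suc t) H hH) s x≁y)
  where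
  x≢y : fromℕ (3 + t) ≢ y
  x≢y x≡y = w≢x (cong inject₁ (sym x≡y))
  x≁y : ∀ {s′} → s′ < s → ¬ Step (restrict H) s′ (fromℕ (3 + t)) y
  x≁y s′<s xy with trans (sym (IsH-frozen t (restrict H) hK (s≤s⁻¹ (≤-trans s′<s s≤1+t)) xy)) x≁w
  ... | ()

IsH-non-neighbour : ∀ t (H : Graph (4 + t)) → IsH (suc t) H → ∃ λ z → fromℕ (3 + t) ≢ z × adj H (fromℕ (3 + t)) z ≡ false
IsH-non-neighbour t H hH
  with adj H (fromℕ (3 + t)) zero in v0 | adj H (fromℕ (3 + t)) (suc zero) in v1 | adj H (fromℕ (3 + t)) (suc (suc zero)) in v2
... | false | _     | _     = zero , (λ ()) , v0
... | true  | false | _     = suc zero , (λ ()) , v1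
... | true  | true  | false = suc (suc zero) , (λ ()) , v2
... | true  | true  | true  =
  contradiction (distinct⇒3≤∣p∣ (λ ()) (λ ()) (λ ()) (∈-neighbours⁺ H v0) (∈-neighbours⁺ H v1) (∈-neighbours⁺ H v2))
                (<⇒≱ (s≤s (IsH-∣N∣≤2 t H hH)))

IsH-satTime : ∀ t (H : Graph (4 + t)) → IsH (suc t) H → SatTime H (suc t)
IsH-satTime t H hH = (λ s a b ab → IsH-complete t H hH (Step-irrefl H s ab)) , earliest
  where
  earliest : ∀ t′ → t′ < suc t → ¬ IsFinal H t′
  earliest t′ t′<1+t final with IsH-non-neighbour t H hH
  ... | z , v≢z , v≁z =
    contradiction (IsH-frozen t H hH ≤-refl (Step-mono H (s≤s⁻¹ t′<1+t) (final (suc t) _ _ (IsH-complete t H hH v≢z))))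
                  (λ v~z → contradiction (trans (sym v~z) v≁z) (λ ()))

IsH-edgeCount : ∀ t (H : Graph (4 + t)) → IsH (suc t) H → edgeCount H ≡ 2 * suc t + 3
IsH-edgeCount zero H (hK , deg) = trans (Extension.edgeCount-extend H) (cong₂ _+_ (triangle-edgeCount (restrict H) hK) deg)
IsH-edgeCount (suc t) H (hK , _ , deg , _) =
  trans (Extension.edgeCount-extend H) (trans (cong₂ _+_ (IsH-edgeCount t (restrict H) hK) deg) (+2 t))
  where
  +2 : ∀ t → 2 * suc t + 3 + 2 ≡ 2 * suc (suc t) + 3
  +2 = solve-∀

theorem3 : ((n : ℕ) (G : Graph n) (t : ℕ) → SatTime G t → 1 ≤ t → 2 * t + 3 ≤ edgeCount G)
    ×
    ((t : ℕ) → 1 ≤ t → (H : Graph (3 + t)) → IsH t H →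
    (edgeCount H ≡ 2 * t + 3) × SatTime H t ×
    ((n : ℕ) (G : Graph n) → SatTime G t → edgeCount H ≤ edgeCount G))
theorem3 = (λ n G t → 2τ+3≤edgeCount G) , Hₜ-minimal
  where
  Hₜ-minimal : (t : ℕ) → 1 ≤ t → (H : Graph (3 + t)) → IsH t H →
               (edgeCount H ≡ 2 * t + 3) × SatTime H t × ((n : ℕ) (G : Graph n) → SatTime G t → edgeCount H ≤ edgeCount G)
  Hₜ-minimal (suc t) _ H hH =
    IsH-edgeCount t H hH , IsH-satTime t H hH ,
    λ n G τ≡t → subst (_≤ edgeCount G) (sym (IsH-edgeCount t H hH)) (2τ+3≤edgeCount G τ≡t (s≤s z≤n))
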